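{- For every integer $n\geq 1$, the number of set partitions $\Pi$ of $[n]$ such that $\mathrm{Flatten}(\Pi)$ avoids the pattern $231$ is the Catalan number $C_n=\frac{1}{n+1}\binom{2n}{n}$.
   Context: A set partition $\Pi$ of $[n]=\{1,\dots,n\}$ is written in standard increasing form: the entries within each block are listed in increasing order, and the blocks are listed in increasing order of their smallest (first) entries. $\mathrm{Flatten}(\Pi)$ is the permutation of $[n]$ (in one-line notation) obtained by concatenating the blocks of $\Pi$ written in this standard increasing form; e.g. $\Pi = 136\text{ - }279\text{ - }4\text{ - }58$ gives $\mathrm{Flatten}(\Pi)=136279458$. A permutation $p=p_1\cdots p_n$ avoids a pattern $\pi=\pi_1\cdots\pi_m$ (a permutation of $[m]$) if there are no indices $i_1<\dots<i_m$ such that $p_{i_1},\dots,p_{i_m}$ are in the same relative order as $\pi_1,\dots,\pi_m$. -}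

module Defs where

open import Data.Nat using (ℕ; zero; suc; _+_; _*_; _<_; _/_)
open import Data.Nat.Combinatorics using (_C_)
open import Data.Fin using (Fin) renaming (_<_ to _<ᶠ_)
open import Data.List using (List; []; _∷_; length; lookup; concat; map; upTo)
open import Data.List.Relation.Unary.All using (All)
open import Data.List.Relation.Unary.Linked using (Linked)
open import Data.List.Relation.Unary.Unique.Propositional using (Unique)
open import Data.List.Relation.Binary.Permutation.Propositional using (_↭_)
open import Data.List.Membership.Propositional using (_∈_)
open import Data.Product using (_×_; ∃; Σ)
open import Data.Empty using (⊥)
open import Function.Bundles using (_⇔_)
open import Relation.Nullary using (¬_)
open import Relation.Binary.PropositionalEquality using (_≡_)

range1 : ℕ → List ℕ
range1 n = map suc (upTo n)

FirstLt : List ℕ → List ℕ → Set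
FirstLt (x ∷ _) (y ∷ _) = x < y
FirstLt _ _ = ⊥

-- A set partition of [n] written in standard increasing form, as a list of blocks:
-- every block nonempty and listed in increasing order, blocks listed in increasing
-- order of their first entries, and the blocks are pairwise disjoint and cover [n]
-- (their concatenation is a rearrangement of 1..n).
-- The standard form is unique, so such lists correspond bijectively to set partitions.
record IsSetPartition (n : ℕ) (Π : List (List ℕ)) : Set where
  field
    nonempty   : All (λ b → ¬ (b ≡ [])) Π
    increasing : All (Linked _<_) Π
    ordered    : Linked FirstLt Π
    exactCover : concat Π ↭ range1 n

Flatten : List (List ℕ) → List ℕ
Flatten = concat

Contains : List ℕ → List ℕ → Set
Contains p π =
  Σ (Fin (length π) → Fin (length p)) λ f →
    (∀ a b → a <ᶠ b → f a <ᶠ f b) ×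
    (∀ a b → (lookup π a < lookup π b) ⇔ (lookup p (f a) < lookup p (f b)))

Avoids : List ℕ → List ℕ → Set
Avoids p π = ¬ Contains p π

pat231 : List ℕ
pat231 = 2 ∷ 3 ∷ 1 ∷ []

catalan : ℕ → ℕ
catalan n = ((2 * n) C n) / suc n

-- "the number of objects satisfying P is k": some duplicate-free list enumerates
-- exactly the objects satisfying P, and it has length k.
HasCount : {A : Set} → (A → Set) → ℕ → Set
HasCount {A} P k = Σ (List A) λ L → Unique L × (∀ x → (x ∈ L) ⇔ P x) × (length L ≡ k)

-- Call a set partition of [n] good if its flattening avoids 231.  In a good partition
-- of [n+1] the entry m = n + 1 ends its block, and deleting it leaves a good partition
-- of [n], its parent.  Conversely, call a block B of a good partition P of [n] active
-- if in Flatten P everything up to the end of B lies below everything after B.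
-- Appending m to a block keeps 231 away exactly when the block is active, and opening
-- the new block {m} always does; these are the children of P.  If P has k active
-- blocks, its children have 1, 2, …, k + 1, so the good partitions form the Catalan
-- generating tree (k) ↦ (1)(2)⋯(k+1) rooted at the empty partition, labelled 0.
module Submission where

open import Defs
open import Data.Nat
open import Data.Nat.Properties
open import Data.Nat.Combinatorics using (_C_; nCk+nC[k+1]≡[n+1]C[k+1]; nCk≡nC[n∸k])
open import Data.Nat.DivMod using (m*n/n≡m)
open import Data.Nat.ListAction using (sum)
open import Data.Nat.ListAction.Properties using (sum-++)
open import Data.Nat.Tactic.RingSolver using (solve-∀)
open import Data.Fin using (Fin; zero; suc) renaming (_<_ to _<ᶠ_)
open import Data.List using (List; []; _∷_; _++_; _∷ʳ_; map; upTo; applyUpTo; concatMap; filter; length; lookup)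
open import Data.List.Properties
  using (++-assoc; ++-identityʳ; concat-++; map-∘; map-cong; map-id; map-upTo; map-++; upTo-∷ʳ;
         filter-all; filter-++; filter-reject)
open import Data.List.Relation.Unary.Any using (Any; here; there)
import Data.List.Relation.Unary.Any.Properties as Any
open import Data.List.Relation.Unary.All as All using (All; []; _∷_; all?)
import Data.List.Relation.Unary.All.Properties as All
open import Data.List.Relation.Unary.Linked as Linked using (Linked; []; [-]; _∷_)
open import Data.List.Relation.Unary.Unique.Propositional using (Unique; []; _∷_)
import Data.List.Relation.Unary.Unique.Propositional.Properties as Unique
open import Data.List.Membership.Propositional using (_∈_; find; lose)
open import Data.List.Membership.Propositional.Properties
  using (∈-map⁻; ∈-upTo⁻; ∈-++⁻; ∈-++⁺ˡ; ∈-++⁺ʳ; ∈-∃++; ∈-concat⁻′; ∈-concatMap⁺; ∈-concatMap⁻)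
open import Data.List.Relation.Binary.Permutation.Propositional using (_↭_; ↭-refl; ↭-sym; ↭-trans)
open import Data.List.Relation.Binary.Permutation.Propositional.Properties
  using (∈-resp-↭; shift; ∷↭∷ʳ; ++⁺ʳ; drop-mid; ↭-empty-inv)
open import Data.Product using (Σ; _×_; _,_; proj₁)
open import Data.Sum using (_⊎_; inj₁; inj₂)
open import Data.Empty using (⊥; ⊥-elim)
open import Relation.Nullary using (¬_; Dec; yes; no)
open import Relation.Binary.PropositionalEquality
open import Function using (_∘_; _∘′_)
open import Function.Bundles using (_⇔_; mk⇔; Equivalence)

open IsSetPartition

range1-snoc : ∀ n → range1 (suc n) ≡ range1 n ++ suc n ∷ []
range1-snoc n = trans (cong (map suc) (sym (upTo-∷ʳ n))) (map-++ suc (upTo n) (n ∷ []))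

-- leaves k s is the number of nodes at depth k below a node labelled s in the
-- Catalan generating tree, whose succession rule is  (s) ↦ (1) (2) … (s+1).
leaves : ℕ → ℕ → ℕ
leaves zero    s = 1
leaves (suc k) s = sum (map (leaves k) (range1 (suc s)))

-- Raising the root label by one adds exactly one child, labelled s+2.
leaves-step : ∀ k s → leaves (suc k) (suc s) ≡ leaves (suc k) s + leaves k (suc (suc s))
leaves-step k s = begin
  sum (map (leaves k) (range1 (suc (suc s))))
    ≡⟨ cong (λ l → sum (map (leaves k) l)) (range1-snoc (suc s)) ⟩
  sum (map (leaves k) (range1 (suc s) ++ suc (suc s) ∷ []))
    ≡⟨ cong sum (map-++ (leaves k) (range1 (suc s)) _) ⟩
  sum (map (leaves k) (range1 (suc s)) ++ leaves k (suc (suc s)) ∷ [])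
    ≡⟨ sum-++ (map (leaves k) (range1 (suc s))) _ ⟩
  leaves (suc k) s + (leaves k (suc (suc s)) + 0)
    ≡⟨ cong (leaves (suc k) s +_) (+-identityʳ _) ⟩
  leaves (suc k) s + leaves k (suc (suc s)) ∎
  where open ≡-Reasoning

-- Binomial coefficients by Pascal's rule; unlike _C_ they compute by recursion.
binom : ℕ → ℕ → ℕ
binom _       zero    = 1
binom zero    (suc k) = 0
binom (suc n) (suc k) = binom n k + binom n (suc k)

binom≡C : ∀ n k → binom n k ≡ n C k
binom≡C n       zero    = refl
binom≡C zero    (suc k) = refl
binom≡C (suc n) (suc k) =
  trans (cong₂ _+_ (binom≡C n k) (binom≡C n (suc k))) (nCk+nC[k+1]≡[n+1]C[k+1] n k)

binom-sym : ∀ {n} a b → a + b ≡ n → binom n a ≡ binom n b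
binom-sym a b refl = begin
  binom (a + b) a          ≡⟨ binom≡C (a + b) a ⟩
  (a + b) C a              ≡⟨ nCk≡nC[n∸k] (m≤m+n a b) ⟩
  (a + b) C (a + b ∸ a)    ≡⟨ cong ((a + b) C_) (m+n∸m≡n a b) ⟩
  (a + b) C b              ≡⟨ binom≡C (a + b) b ⟨
  binom (a + b) b          ∎
  where open ≡-Reasoning

binom⁻ : ℕ → ℕ → ℕ
binom⁻ n zero    = 0
binom⁻ n (suc k) = binom n k

-- Pascal's rule in the form valid for every k, including k = 0.
pascal : ∀ n k → binom (suc n) k ≡ binom⁻ n k + binom n k
pascal n zero    = refl
pascal n (suc k) = refl

absorb : ∀ n k → suc k * binom (suc n) (suc k) ≡ suc n * binom n k
absorb zero    zero    = refl
absorb zero    (suc k) = *-zeroʳ (suc (suc k))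
absorb (suc n) zero    = begin
  1 * (1 + binom (suc n) 1) ≡⟨ *-identityˡ _ ⟩
  1 + binom (suc n) 1       ≡⟨ cong suc (trans (sym (*-identityˡ _)) (absorb n 0)) ⟩
  1 + suc n * 1             ∎
  where open ≡-Reasoning
absorb (suc n) (suc k) = begin
  suc (suc k) * (X + Y)                ≡⟨ expand k X Y ⟩
  suc k * X + X + suc (suc k) * Y      ≡⟨ cong₂ (λ u v → u + X + v) (absorb n k) (absorb n (suc k)) ⟩
  suc n * P + (P + R) + suc n * R      ≡⟨ collect n P R ⟩
  suc (suc n) * (P + R)                ∎
  where
  open ≡-Reasoning
  X = binom (suc n) (suc k)
  Y = binom (suc n) (suc (suc k))
  P = binom n k
  R = binom n (suc k)
  -- X reduces to P + R by Pascal's rule, which is how the middle step typechecks.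
  expand : ∀ k X Y → suc (suc k) * (X + Y) ≡ suc k * X + X + suc (suc k) * Y
  expand = solve-∀
  collect : ∀ n P R → suc n * P + (P + R) + suc n * R ≡ suc (suc n) * (P + R)
  collect = solve-∀

-- width k s = 2k + s, by the recursion that matches the ballot formula below.
width : ℕ → ℕ → ℕ
width zero    s = s
width (suc k) s = suc (suc (width k s))

width-suc : ∀ k s → width k (suc s) ≡ suc (width k s)
width-suc zero    s = refl
width-suc (suc k) s = cong (suc ∘′ suc) (width-suc k s)

width-zero : ∀ k → width k 0 ≡ k + k
width-zero zero    = refl
width-zero (suc k) = cong suc (trans (cong suc (width-zero k)) (sym (+-suc k k)))

ballot : ∀ k s → leaves k s + binom⁻ (width k s) k ≡ binom (width k s) k
ballot zero    s       = refl
ballot (suc m) zero    = begin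
  leaves (suc m) 0 + binom (suc w) m
    ≡⟨ cong₂ _+_ (+-identityʳ _) (pascal w m) ⟩
  leaves m 1 + (binom⁻ w m + binom w m)
    ≡⟨ +-assoc (leaves m 1) _ _ ⟨
  leaves m 1 + binom⁻ w m + binom w m
    ≡⟨ cong (_+ binom w m) ballot-at-1 ⟩
  binom w m + binom w m
    ≡⟨ cong (binom w m +_) central-sym ⟩
  binom w m + binom w (suc m) ∎
  where
  open ≡-Reasoning
  w = suc (width m 0)
  ballot-at-1 : leaves m 1 + binom⁻ w m ≡ binom w m
  ballot-at-1 = subst (λ t → leaves m 1 + binom⁻ t m ≡ binom t m) (width-suc m 0) (ballot m 1)
  central-sym : binom w m ≡ binom w (suc m)
  central-sym = binom-sym m (suc m) (trans (+-suc m m) (cong suc (sym (width-zero m))))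
ballot (suc m) (suc s) = begin
  leaves (suc m) (suc s) + binom (width (suc m) (suc s)) m
    ≡⟨ cong₂ _+_ (leaves-step m s) (cong (λ t → binom t m) (width-suc (suc m) s)) ⟩
  (L₁ + L₂) + binom (suc a) m
    ≡⟨ cong ((L₁ + L₂) +_) (pascal a m) ⟩
  (L₁ + L₂) + (binom⁻ a m + binom a m)
    ≡⟨ regroup L₁ L₂ (binom⁻ a m) (binom a m) ⟩
  (L₁ + binom a m) + (L₂ + binom⁻ a m)
    ≡⟨ cong₂ _+_ (ballot (suc m) s) ballot-at-a ⟩
  binom a (suc m) + binom a m
    ≡⟨ +-comm (binom a (suc m)) (binom a m) ⟩
  binom (suc a) (suc m)
    ≡⟨ cong (λ t → binom t (suc m)) (width-suc (suc m) s) ⟨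
  binom (width (suc m) (suc s)) (suc m) ∎
  where
  open ≡-Reasoning
  a  = width (suc m) s
  L₁ = leaves (suc m) s
  L₂ = leaves m (suc (suc s))
  ballot-at-a : L₂ + binom⁻ a m ≡ binom a m
  ballot-at-a = subst (λ t → L₂ + binom⁻ t m ≡ binom t m)
    (trans (width-suc m (suc s)) (cong suc (width-suc m s))) (ballot m (suc (suc s)))
  regroup : ∀ w x y z → (w + x) + (y + z) ≡ (w + z) + (x + y)
  regroup = solve-∀

central-ratio : ∀ p → suc p * binom (suc (suc (p + p))) (suc p)
                    ≡ suc (suc p) * binom (suc (suc (p + p))) p
central-ratio p = begin
  suc p * binom (suc M) (suc p)              ≡⟨ absorb M p ⟩
  suc M * binom M p                          ≡⟨ cong (suc M *_) (binom-sym p (suc p) (+-suc p p)) ⟩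
  suc M * binom M (suc p)                    ≡⟨ absorb M (suc p) ⟨
  suc (suc p) * binom (suc M) (suc (suc p))  ≡⟨ cong (suc (suc p) *_) sym₂ ⟨
  suc (suc p) * binom (suc M) p              ∎
  where
  open ≡-Reasoning
  M = suc (p + p)
  sym₂ : binom (suc M) p ≡ binom (suc M) (suc (suc p))
  sym₂ = binom-sym p (suc (suc p)) (trans (+-suc p (suc p)) (cong suc (+-suc p p)))

catalan≡leaves : ∀ n → catalan n ≡ leaves n 0
catalan≡leaves zero    = refl
catalan≡leaves (suc p) = begin
  ((2 * suc p) C suc p) / suc (suc p)       ≡⟨ cong (λ t → (t C suc p) / suc (suc p)) two-p+2 ⟩
  (N C suc p) / suc (suc p)                 ≡⟨ cong (_/ suc (suc p)) (binom≡C N (suc p)) ⟨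
  binom N (suc p) / suc (suc p)             ≡⟨ cong (_/ suc (suc p)) leaves-times ⟨
  (leaves (suc p) 0 * suc (suc p)) / suc (suc p) ≡⟨ m*n/n≡m (leaves (suc p) 0) (suc (suc p)) ⟩
  leaves (suc p) 0                          ∎
  where
  open ≡-Reasoning
  N = suc (suc (p + p))
  two-p+2 : 2 * suc p ≡ N
  two-p+2 = cong suc (trans (cong (p +_) (+-identityʳ (suc p))) (+-suc p p))
  ballot₀ : leaves (suc p) 0 + binom N p ≡ binom N (suc p)
  ballot₀ = subst (λ t → leaves (suc p) 0 + binom t p ≡ binom t (suc p))
    (cong (suc ∘′ suc) (width-zero p)) (ballot (suc p) 0)
  -- With x = leaves, y = C(N,p), z = C(N,p+1):  x + y = z  and  (p+1)z = (p+2)y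
  -- give x·(p+2) = z.
  leaves-times : leaves (suc p) 0 * suc (suc p) ≡ binom N (suc p)
  leaves-times = +-cancelʳ-≡ (suc (suc p) * y) _ _ (begin
    x * suc (suc p) + suc (suc p) * y ≡⟨ factor x (suc (suc p)) y ⟩
    suc (suc p) * (x + y)             ≡⟨ cong (suc (suc p) *_) ballot₀ ⟩
    suc (suc p) * z                   ≡⟨⟩
    z + suc p * z                     ≡⟨ cong (z +_) (central-ratio p) ⟩
    z + suc (suc p) * y               ∎)
    where
    x = leaves (suc p) 0
    y = binom N p
    z = binom N (suc p)
    factor : ∀ a b c → a * b + b * c ≡ b * (a + c)
    factor = solve-∀

-- Plays2 x ys: some later entry of ys exceeds x and a still later one is below x,
-- so that x can play the role of the "2" in an occurrence of 231.
Plays2 : ℕ → List ℕ → Set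
Plays2 x []       = ⊥
Plays2 x (y ∷ ys) = (x < y × Any (_< x) ys) ⊎ Plays2 x ys

Has231 : List ℕ → Set
Has231 []       = ⊥
Has231 (x ∷ xs) = Plays2 x xs ⊎ Has231 xs

Occurrence : List ℕ → Set
Occurrence p = Σ (Fin (length p)) λ i → Σ (Fin (length p)) λ j → Σ (Fin (length p)) λ k →
  (i <ᶠ j) × (j <ᶠ k) × (lookup p k < lookup p i) × (lookup p i < lookup p j)

any⇒position : ∀ {P : ℕ → Set} xs → Any P xs → Σ (Fin (length xs)) λ k → P (lookup xs k)
any⇒position (x ∷ xs) (here p)  = zero , p
any⇒position (x ∷ xs) (there a) with k , p ← any⇒position xs a = suc k , p

position⇒any : ∀ {P : ℕ → Set} xs (k : Fin (length xs)) → P (lookup xs k) → Any P xs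
position⇒any (x ∷ xs) zero    p = here p
position⇒any (x ∷ xs) (suc k) p = there (position⇒any xs k p)

Plays2-positions : ℕ → List ℕ → Set
Plays2-positions x ys = Σ (Fin (length ys)) λ j → Σ (Fin (length ys)) λ k →
  (j <ᶠ k) × (lookup ys k < x) × (x < lookup ys j)

plays2⇒positions : ∀ x ys → Plays2 x ys → Plays2-positions x ys
plays2⇒positions x (y ∷ ys) (inj₁ (x<y , a)) with k , p ← any⇒position ys a =
  zero , suc k , s≤s z≤n , p , x<y
plays2⇒positions x (y ∷ ys) (inj₂ h) with j , k , j<k , p , q ← plays2⇒positions x ys h =
  suc j , suc k , s≤s j<k , p , q

positions⇒plays2 : ∀ x ys → Plays2-positions x ys → Plays2 x ys
positions⇒plays2 x (y ∷ ys) (zero  , suc k , _ , p , q)         = inj₁ (q , position⇒any ys k p)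
positions⇒plays2 x (y ∷ ys) (suc j , suc k , s≤s j<k , p , q) = inj₂ (positions⇒plays2 x ys (j , k , j<k , p , q))

has231⇒occurrence : ∀ p → Has231 p → Occurrence p
has231⇒occurrence (x ∷ xs) (inj₁ h) with j , k , j<k , p , q ← plays2⇒positions x xs h =
  zero , suc j , suc k , s≤s z≤n , s≤s j<k , p , q
has231⇒occurrence (x ∷ xs) (inj₂ h) with i , j , k , i<j , j<k , p , q ← has231⇒occurrence xs h =
  suc i , suc j , suc k , s≤s i<j , s≤s j<k , p , q

occurrence⇒has231 : ∀ p → Occurrence p → Has231 p
occurrence⇒has231 (x ∷ xs) (zero , suc j , suc k , _ , s≤s j<k , p , q) =
  inj₁ (positions⇒plays2 x xs (j , k , j<k , p , q))
occurrence⇒has231 (x ∷ xs) (suc i , suc j , suc k , s≤s i<j , s≤s j<k , p , q) =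
  inj₂ (occurrence⇒has231 xs (i , j , k , i<j , j<k , p , q))

contains⇒occurrence : ∀ p → Contains p pat231 → Occurrence p
contains⇒occurrence p (f , mono , iff) =
  f 0F , f 1F , f 2F , mono 0F 1F (s≤s z≤n) , mono 1F 2F (s≤s (s≤s z≤n)) ,
  Equivalence.to (iff 2F 0F) (s≤s (s≤s z≤n)) , Equivalence.to (iff 0F 1F) (s≤s (s≤s (s≤s z≤n)))
  where
  0F 1F 2F : Fin 3
  0F = zero
  1F = suc zero
  2F = suc (suc zero)

occurrence⇒contains : ∀ p → Occurrence p → Contains p pat231
occurrence⇒contains p (i , j , k , i<j , j<k , c<a , a<b) = f , mono , iff
  where
  f : Fin 3 → Fin (length p)
  f zero             = i
  f (suc zero)       = j
  f (suc (suc zero)) = k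
  mono : ∀ s t → s <ᶠ t → f s <ᶠ f t
  mono zero             (suc zero)       _                 = i<j
  mono zero             (suc (suc zero)) _                 = <-trans i<j j<k
  mono (suc zero)       (suc (suc zero)) _                 = j<k
  mono (suc zero)       (suc zero)       (s≤s ())
  mono (suc (suc zero)) (suc (suc zero)) (s≤s (s≤s ()))
  mono (suc (suc zero)) (suc zero)       (s≤s ())
  mono zero             zero             ()
  mono (suc _)          zero             ()
  both : ∀ {A B : Set} → A → B → A ⇔ B
  both a b = mk⇔ (λ _ → b) (λ _ → a)
  neither : ∀ {A B : Set} → ¬ A → ¬ B → A ⇔ B
  neither na nb = mk⇔ (⊥-elim ∘ na) (⊥-elim ∘ nb)
  iff : ∀ s t → (lookup pat231 s < lookup pat231 t) ⇔ (lookup p (f s) < lookup p (f t))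
  iff zero             zero             = neither (<-irrefl refl) (<-irrefl refl)
  iff zero             (suc zero)       = both (s≤s (s≤s (s≤s z≤n))) a<b
  iff zero             (suc (suc zero)) = neither (λ { (s≤s ()) }) (<-asym c<a)
  iff (suc zero)       zero             = neither (λ { (s≤s (s≤s ())) }) (<-asym a<b)
  iff (suc zero)       (suc zero)       = neither (<-irrefl refl) (<-irrefl refl)
  iff (suc zero)       (suc (suc zero)) = neither (λ { (s≤s ()) }) (<-asym (<-trans c<a a<b))
  iff (suc (suc zero)) zero             = both (s≤s (s≤s z≤n)) c<a
  iff (suc (suc zero)) (suc zero)       = both (s≤s (s≤s z≤n)) (<-trans c<a a<b)
  iff (suc (suc zero)) (suc (suc zero)) = neither (<-irrefl refl) (<-irrefl refl)

avoids⇔¬has231 : ∀ p → Avoids p pat231 ⇔ (¬ Has231 p)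
avoids⇔¬has231 p = mk⇔
  (λ av h → av (occurrence⇒contains p (has231⇒occurrence p h)))
  (λ nh c → nh (occurrence⇒has231 p (contains⇒occurrence p c)))

Below : List ℕ → List ℕ → Set
Below X Y = All (λ a → All (a ≤_) Y) X

Crossing : List ℕ → List ℕ → Set
Crossing X Y = Any (λ a → Any (_< a) Y) X

below⇒¬crossing : ∀ {X Y} → Below X Y → ¬ Crossing X Y
below⇒¬crossing = All.All¬⇒¬Any ∘ All.map (λ a≤Y → All.All¬⇒¬Any (All.map (λ a≤y y<a → <⇒≱ y<a a≤y) a≤Y))

¬crossing⇒below : ∀ X Y → ¬ Crossing X Y → Below X Y
¬crossing⇒below X Y ¬c = All.map (λ ¬a → All.map ≮⇒≥ (All.¬Any⇒All¬ Y ¬a)) (All.¬Any⇒All¬ X ¬c)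

any-insert : ∀ {P : ℕ → Set} xs ys m → Any P (xs ++ ys) → Any P (xs ++ m ∷ ys)
any-insert []       ys m a         = there a
any-insert (x ∷ xs) ys m (here p)  = here p
any-insert (x ∷ xs) ys m (there a) = there (any-insert xs ys m a)

any-delete : ∀ {P : ℕ → Set} xs ys m → ¬ P m → Any P (xs ++ m ∷ ys) → Any P (xs ++ ys)
any-delete []       ys m ¬pm (here pm) = ⊥-elim (¬pm pm)
any-delete []       ys m ¬pm (there a) = a
any-delete (x ∷ xs) ys m ¬pm (here p)  = here p
any-delete (x ∷ xs) ys m ¬pm (there a) = there (any-delete xs ys m ¬pm a)

plays2-insert : ∀ x xs ys m → Plays2 x (xs ++ ys) → Plays2 x (xs ++ m ∷ ys)
plays2-insert x []       ys m h                = inj₂ h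
plays2-insert x (y ∷ xs) ys m (inj₁ (x<y , a)) = inj₁ (x<y , any-insert xs ys m a)
plays2-insert x (y ∷ xs) ys m (inj₂ h)         = inj₂ (plays2-insert x xs ys m h)

has231-insert : ∀ xs ys m → Has231 (xs ++ ys) → Has231 (xs ++ m ∷ ys)
has231-insert []       ys m h        = inj₂ h
has231-insert (x ∷ xs) ys m (inj₁ h) = inj₁ (plays2-insert x xs ys m h)
has231-insert (x ∷ xs) ys m (inj₂ h) = inj₂ (has231-insert xs ys m h)

avoids-delete : ∀ xs ys m → ¬ Has231 (xs ++ m ∷ ys) → ¬ Has231 (xs ++ ys)
avoids-delete xs ys m nh h = nh (has231-insert xs ys m h)

plays2-through : ∀ x zs ys m → x < m → Any (_< x) ys → Plays2 x (zs ++ m ∷ ys)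
plays2-through x []       ys m x<m a = inj₁ (x<m , a)
plays2-through x (z ∷ zs) ys m x<m a = inj₂ (plays2-through x zs ys m x<m a)

crossing-insert : ∀ xs ys m → All (_< m) xs → Crossing xs ys → Has231 (xs ++ m ∷ ys)
crossing-insert (x ∷ xs) ys m (x<m ∷ _)  (here a)  = inj₁ (plays2-through x xs ys m x<m a)
crossing-insert (x ∷ xs) ys m (_ ∷ all<) (there c) = inj₂ (crossing-insert xs ys m all< c)

avoids⇒below : ∀ xs ys m → All (_< m) xs → ¬ Has231 (xs ++ m ∷ ys) → Below xs ys
avoids⇒below xs ys m xs<m nh = ¬crossing⇒below xs ys (nh ∘ crossing-insert xs ys m xs<m)

-- Conversely, an occurrence of 231 through a new maximum m is either an old
-- occurrence or uses m as its "3", hence comes from a crossing pair.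
plays2-remove : ∀ x xs ys m → x < m → Plays2 x (xs ++ m ∷ ys) → Plays2 x (xs ++ ys) ⊎ Any (_< x) ys
plays2-remove x []       ys m x<m (inj₁ (_ , a)) = inj₂ a
plays2-remove x []       ys m x<m (inj₂ h)       = inj₁ h
plays2-remove x (y ∷ xs) ys m x<m (inj₁ (x<y , a)) =
  inj₁ (inj₁ (x<y , any-delete xs ys m (λ m<x → <-asym m<x x<m) a))
plays2-remove x (y ∷ xs) ys m x<m (inj₂ h) with plays2-remove x xs ys m x<m h
... | inj₁ h′ = inj₁ (inj₂ h′)
... | inj₂ a  = inj₂ a

¬plays2-max : ∀ m ys → All (_< m) ys → ¬ Plays2 m ys
¬plays2-max m (y ∷ ys) (y<m ∷ _)  (inj₁ (m<y , _)) = <-asym m<y y<m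
¬plays2-max m (y ∷ ys) (_ ∷ ys<m) (inj₂ h)         = ¬plays2-max m ys ys<m h

has231-remove : ∀ xs ys m → All (_< m) xs → All (_< m) ys →
  Has231 (xs ++ m ∷ ys) → Has231 (xs ++ ys) ⊎ Crossing xs ys
has231-remove []       ys m _           ys<m (inj₁ h) = ⊥-elim (¬plays2-max m ys ys<m h)
has231-remove []       ys m _           ys<m (inj₂ h) = inj₁ h
has231-remove (x ∷ xs) ys m (x<m ∷ _)   ys<m (inj₁ h) with plays2-remove x xs ys m x<m h
... | inj₁ h′ = inj₁ (inj₁ h′)
... | inj₂ a  = inj₂ (here a)
has231-remove (x ∷ xs) ys m (_ ∷ xs<m) ys<m (inj₂ h) with has231-remove xs ys m xs<m ys<m h
... | inj₁ h′ = inj₁ (inj₂ h′)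
... | inj₂ c  = inj₂ (there c)

avoids-insert-max : ∀ xs ys m → All (_< m) xs → All (_< m) ys →
  ¬ Has231 (xs ++ ys) → Below xs ys → ¬ Has231 (xs ++ m ∷ ys)
avoids-insert-max xs ys m xs<m ys<m nh below h with has231-remove xs ys m xs<m ys<m h
... | inj₁ h′ = nh h′
... | inj₂ c  = below⇒¬crossing below c

Blocks : Set
Blocks = List (List ℕ)

Flatten-snoc : ∀ (P : Blocks) B → Flatten (P ∷ʳ B) ≡ Flatten P ++ B
Flatten-snoc P B = trans (sym (concat-++ P (B ∷ []))) (cong (Flatten P ++_) (++-identityʳ B))

Flatten-mid : ∀ (P : Blocks) B S → Flatten (P ++ B ∷ S) ≡ Flatten P ++ B ++ Flatten S
Flatten-mid P B S = sym (concat-++ P (B ∷ S))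

below? : ∀ X Y → Dec (Below X Y)
below? X Y = all? (λ a → all? (a ≤?_) Y) X

indicator : {A : Set} → Dec A → ℕ
indicator (yes _) = 1
indicator (no _)  = 0

indicator-yes : {A : Set} (d : Dec A) → A → indicator d ≡ 1
indicator-yes (yes _) _ = refl
indicator-yes (no ¬a) a = ⊥-elim (¬a a)

indicator-no : {A : Set} (d : Dec A) → ¬ A → indicator d ≡ 0
indicator-no (yes a) ¬a = ⊥-elim (¬a a)
indicator-no (no _)  _  = refl

indicator-cong : {A B : Set} (d : Dec A) (e : Dec B) → (A → B) → (B → A) → indicator d ≡ indicator e
indicator-cong (yes a) e f g = sym (indicator-yes e (f a))
indicator-cong (no ¬a) e f g = sym (indicator-no e (¬a ∘ g))

-- A block B of a word  p · B₁ ⋯ B · S · t  is active when everything up to and including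
-- B lies below everything after it; activeCount p Q t counts the active blocks of Q.
activeCount : List ℕ → Blocks → List ℕ → ℕ
activeCount p []      t = 0
activeCount p (B ∷ S) t = indicator (below? (p ++ B) (Flatten S ++ t)) + activeCount (p ++ B) S t

label : Blocks → ℕ
label Π = activeCount [] Π []

activeCount-++ : ∀ p Q R t → activeCount p (Q ++ R) t ≡ activeCount p Q (Flatten R ++ t) + activeCount (p ++ Flatten Q) R t
activeCount-++ p []      R t = cong (λ z → activeCount z R t) (sym (++-identityʳ p))
activeCount-++ p (B ∷ Q) R t = begin
  i (Flatten (Q ++ R) ++ t) + activeCount (p ++ B) (Q ++ R) t
    ≡⟨ cong₂ _+_ (cong i tail-eq) (activeCount-++ (p ++ B) Q R t) ⟩
  i (Flatten Q ++ Flatten R ++ t) + (activeCount (p ++ B) Q (Flatten R ++ t) + activeCount ((p ++ B) ++ Flatten Q) R t)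
    ≡⟨ +-assoc (i (Flatten Q ++ Flatten R ++ t)) _ _ ⟨
  i (Flatten Q ++ Flatten R ++ t) + activeCount (p ++ B) Q (Flatten R ++ t) + activeCount ((p ++ B) ++ Flatten Q) R t
    ≡⟨ cong (λ z → i (Flatten Q ++ Flatten R ++ t) + activeCount (p ++ B) Q (Flatten R ++ t) + activeCount z R t) (++-assoc p B (Flatten Q)) ⟩
  i (Flatten Q ++ Flatten R ++ t) + activeCount (p ++ B) Q (Flatten R ++ t) + activeCount (p ++ (B ++ Flatten Q)) R t ∎
  where
  open ≡-Reasoning
  i : List ℕ → ℕ
  i Y = indicator (below? (p ++ B) Y)
  tail-eq : Flatten (Q ++ R) ++ t ≡ Flatten Q ++ Flatten R ++ t
  tail-eq = trans (cong (_++ t) (sym (concat-++ Q R))) (++-assoc (Flatten Q) (Flatten R) t)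

below-insert : ∀ {m} X Y Z → All (_≤ m) X → Below X (Y ++ Z) → Below X (Y ++ m ∷ Z)
below-insert []      Y Z []          []         = []
below-insert (x ∷ X) Y Z (x≤m ∷ X≤m) (x≤ ∷ X≤) with x≤Y , x≤Z ← All.++⁻ Y x≤ =
  All.++⁺ x≤Y (x≤m ∷ x≤Z) ∷ below-insert X Y Z X≤m X≤

below-delete : ∀ {m} X Y Z → Below X (Y ++ m ∷ Z) → Below X (Y ++ Z)
below-delete []      Y Z []        = []
below-delete (x ∷ X) Y Z (x≤ ∷ X≤) with x≤Y , _ ∷ x≤Z ← All.++⁻ Y x≤ =
  All.++⁺ x≤Y x≤Z ∷ below-delete X Y Z X≤

activeCount-insert : ∀ p Q u v m → All (_≤ m) p → All (_≤ m) (Flatten Q) →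
  activeCount p Q (u ++ v) ≡ activeCount p Q (u ++ m ∷ v)
activeCount-insert p []      u v m p≤m Q≤m = refl
activeCount-insert p (B ∷ Q) u v m p≤m BQ≤m = cong₂ _+_
  (indicator-cong (below? (p ++ B) (Flatten Q ++ u ++ v)) (below? (p ++ B) (Flatten Q ++ u ++ m ∷ v))
    (λ b → subst (Below (p ++ B)) (++-assoc (Flatten Q) u (m ∷ v))
             (below-insert (p ++ B) (Flatten Q ++ u) v pB≤m (subst (Below (p ++ B)) (sym (++-assoc (Flatten Q) u v)) b)))
    (λ b → subst (Below (p ++ B)) (++-assoc (Flatten Q) u v)
             (below-delete (p ++ B) (Flatten Q ++ u) v (subst (Below (p ++ B)) (sym (++-assoc (Flatten Q) u (m ∷ v))) b))))
  (activeCount-insert (p ++ B) Q u v m pB≤m (All.++⁻ʳ B BQ≤m))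
  where
  pB≤m : All (_≤ m) (p ++ B)
  pB≤m = All.++⁺ p≤m (All.++⁻ˡ B BQ≤m)

¬below : ∀ {m} X Y → Any (m ≤_) X → Any (_< m) Y → ¬ Below X Y
¬below (x ∷ X) Y (here m≤x) y<m (x≤Y ∷ _) = ¬x≤ Y y<m x≤Y
  where
  ¬x≤ : ∀ Y → Any (_< _) Y → ¬ All (x ≤_) Y
  ¬x≤ (y ∷ Y) (here y<m) (x≤y ∷ _)   = <⇒≱ y<m (≤-trans m≤x x≤y)
  ¬x≤ (y ∷ Y) (there a)  (_ ∷ x≤Y′) = ¬x≤ Y a x≤Y′
¬below (x ∷ X) Y (there a) y<m (_ ∷ X≤Y) = ¬below X Y a y<m X≤Y

-- Everything lies below the empty word, so the last block is always active.
below-[] : ∀ X → Below X []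
below-[] []      = []
below-[] (x ∷ X) = [] ∷ below-[] X

NonEmpty : Blocks → Set
NonEmpty = All (λ b → ¬ b ≡ [])

activeCount-after-max : ∀ p B S m → Any (m ≤_) (p ++ B) → All (_< m) (Flatten S) → NonEmpty S →
  activeCount p (B ∷ S) [] ≡ 1
activeCount-after-max p B []              m m≤ _           _         =
  cong (_+ 0) (indicator-yes (below? (p ++ B) []) (below-[] (p ++ B)))
activeCount-after-max p B ([] ∷ S)        m m≤ _           (ne ∷ _)  = ⊥-elim (ne refl)
activeCount-after-max p B ((c ∷ K) ∷ S) m m≤ (c<m ∷ S<m) (_ ∷ nes) = cong₂ _+_
  (indicator-no (below? (p ++ B) ((c ∷ K ++ Flatten S) ++ [])) (¬below _ _ m≤ (here c<m)))
  (activeCount-after-max (p ++ B) (c ∷ K) S m (Any.++⁺ˡ m≤) (All.++⁻ʳ K S<m) nes)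

-- Appending m to the block B of  pre · B · S  yields a child whose label is one more
-- than the number of active blocks of pre: B itself now carries the maximum, so among
-- B and the blocks after it only the last one stays active.
label-extend : ∀ pre B S m → All (_≤ m) (Flatten pre) → All (_< m) (Flatten S) → NonEmpty S →
  label (pre ++ (B ∷ʳ m) ∷ S) ≡ activeCount [] pre (Flatten (B ∷ S) ++ []) + 1
label-extend pre B S m pre≤m S<m neS = begin
  activeCount [] (pre ++ (B ∷ʳ m) ∷ S) []
    ≡⟨ activeCount-++ [] pre ((B ∷ʳ m) ∷ S) [] ⟩
  activeCount [] pre (Flatten ((B ∷ʳ m) ∷ S) ++ []) + activeCount (Flatten pre) ((B ∷ʳ m) ∷ S) []
    ≡⟨ cong₂ _+_ prefix-part suffix-part ⟩
  activeCount [] pre (Flatten (B ∷ S) ++ []) + 1 ∎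
  where
  open ≡-Reasoning
  with-m : Flatten ((B ∷ʳ m) ∷ S) ++ [] ≡ B ++ m ∷ (Flatten S ++ [])
  with-m = trans (++-assoc (B ++ m ∷ []) (Flatten S) []) (++-assoc B (m ∷ []) (Flatten S ++ []))
  without-m : Flatten (B ∷ S) ++ [] ≡ B ++ (Flatten S ++ [])
  without-m = ++-assoc B (Flatten S) []
  prefix-part : activeCount [] pre (Flatten ((B ∷ʳ m) ∷ S) ++ []) ≡ activeCount [] pre (Flatten (B ∷ S) ++ [])
  prefix-part = trans (cong (activeCount [] pre) with-m)
    (sym (trans (cong (activeCount [] pre) without-m) (activeCount-insert [] pre B (Flatten S ++ []) m [] pre≤m)))
  suffix-part : activeCount (Flatten pre) ((B ∷ʳ m) ∷ S) [] ≡ 1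
  suffix-part = activeCount-after-max (Flatten pre) (B ∷ʳ m) S m
    (Any.++⁺ʳ (Flatten pre) (Any.++⁺ʳ B (here ≤-refl))) S<m neS

label-new-block : ∀ Π m → All (_≤ m) (Flatten Π) → label (Π ∷ʳ (m ∷ [])) ≡ label Π + 1
label-new-block Π m Π≤m = begin
  activeCount [] (Π ++ (m ∷ []) ∷ []) []
    ≡⟨ activeCount-++ [] Π ((m ∷ []) ∷ []) [] ⟩
  activeCount [] Π (m ∷ []) + activeCount (Flatten Π) ((m ∷ []) ∷ []) []
    ≡⟨ cong₂ _+_ (sym (activeCount-insert [] Π [] [] m [] Π≤m))
                 (activeCount-after-max (Flatten Π) (m ∷ []) [] m (Any.++⁺ʳ (Flatten Π) (here ≤-refl)) [] []) ⟩
  label Π + 1 ∎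
  where open ≡-Reasoning

-- extensions m pre rest: the block lists  pre · B₁ ⋯ (B ++ m) ⋯  obtained by appending m
-- to an active block B of rest (activity measured in the whole list pre · rest).
extensions : ℕ → Blocks → Blocks → List Blocks
extensions m pre []      = []
extensions m pre (B ∷ S) with below? (Flatten pre ++ B) (Flatten S ++ [])
... | yes _ = (pre ++ (B ∷ʳ m) ∷ S) ∷ extensions m (pre ∷ʳ B) S
... | no  _ = extensions m (pre ∷ʳ B) S

children : ℕ → Blocks → List Blocks
children m Π = extensions m [] Π ++ (Π ∷ʳ (m ∷ [])) ∷ []

range1-shift : ∀ c t → map (c +_) (range1 (suc t)) ≡ c + 1 ∷ map ((c + 1) +_) (range1 t)
range1-shift c t = cong (c + 1 ∷_) (begin
  map (c +_) (map suc (applyUpTo suc t))           ≡⟨ cong (map (c +_) ∘ map suc) (map-upTo suc t) ⟨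
  map (c +_) (map suc (range1 t))                  ≡⟨ map-∘ (range1 t) ⟨
  map (λ x → c + suc x) (range1 t)                 ≡⟨ map-cong (λ x → sym (+-assoc c 1 x)) (range1 t) ⟩
  map ((c + 1) +_) (range1 t)                      ∎)
  where
  open ≡-Reasoning

≤-all : ∀ {m} xs → All (_< m) xs → All (_≤ m) xs
≤-all _ = All.map <⇒≤

labels-rest : ∀ m pre B S → All (_≤ m) (Flatten pre) → All (_< m) (Flatten (B ∷ S)) → NonEmpty S →
  ∀ {d} → activeCount [] (pre ∷ʳ B) (Flatten S ++ []) ≡ d →
  map label (extensions m (pre ∷ʳ B) S) ≡ map (d +_) (range1 (activeCount (Flatten pre ++ B) S []))

labels-extensions : ∀ m pre rest → All (_≤ m) (Flatten pre) → All (_< m) (Flatten rest) → NonEmpty rest →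
  map label (extensions m pre rest)
    ≡ map (activeCount [] pre (Flatten rest ++ []) +_) (range1 (activeCount (Flatten pre) rest []))
labels-extensions m pre []      pre≤m rest<m ne = refl
labels-extensions m pre (B ∷ S) pre≤m BS<m (_ ∷ neS)
  with below? (Flatten pre ++ B) (Flatten S ++ []) | prefix-count
  where
  prefix-count : activeCount [] (pre ∷ʳ B) (Flatten S ++ [])
               ≡ activeCount [] pre (Flatten (B ∷ S) ++ []) + (indicator (below? (Flatten pre ++ B) (Flatten S ++ [])) + 0)
  prefix-count = trans (activeCount-++ [] pre (B ∷ []) (Flatten S ++ []))
    (cong (_+ (indicator (below? (Flatten pre ++ B) (Flatten S ++ [])) + 0)) (cong (activeCount [] pre)
      (trans (cong (_++ (Flatten S ++ [])) (++-identityʳ B)) (sym (++-assoc B (Flatten S) [])))))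
... | yes _ | prefix-count = begin
  label (pre ++ (B ∷ʳ m) ∷ S) ∷ map label (extensions m (pre ∷ʳ B) S)
    ≡⟨ cong₂ _∷_ (label-extend pre B S m pre≤m S<m neS) (labels-rest m pre B S pre≤m BS<m neS prefix-count) ⟩
  c + 1 ∷ map ((c + 1) +_) (range1 t)
    ≡⟨ range1-shift c t ⟨
  map (c +_) (range1 (suc t)) ∎
  where
  open ≡-Reasoning
  c = activeCount [] pre (Flatten (B ∷ S) ++ [])
  t = activeCount (Flatten pre ++ B) S []
  S<m = All.++⁻ʳ B BS<m
... | no _  | prefix-count =
  labels-rest m pre B S pre≤m BS<m neS (trans prefix-count (+-identityʳ _))

labels-rest m pre B S pre≤m BS<m neS refl =
  trans (labels-extensions m (pre ∷ʳ B) S preB≤m (All.++⁻ʳ B BS<m) neS)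
        (cong (λ z → map (activeCount [] (pre ∷ʳ B) (Flatten S ++ []) +_) (range1 (activeCount z S [])))
              (Flatten-snoc pre B))
  where
  preB≤m : All (_≤ m) (Flatten (pre ∷ʳ B))
  preB≤m = subst (All (_≤ m)) (sym (Flatten-snoc pre B)) (All.++⁺ pre≤m (≤-all B (All.++⁻ˡ B BS<m)))

labels-children : ∀ m Π → All (_< m) (Flatten Π) → NonEmpty Π → map label (children m Π) ≡ range1 (suc (label Π))
labels-children m Π Π<m ne = begin
  map label (extensions m [] Π ++ (Π ∷ʳ (m ∷ [])) ∷ [])
    ≡⟨ map-++ label (extensions m [] Π) _ ⟩
  map label (extensions m [] Π) ++ label (Π ∷ʳ (m ∷ [])) ∷ []
    ≡⟨ cong₂ (λ a b → a ++ b ∷ []) (trans (labels-extensions m [] Π [] Π<m ne) (map-id (range1 (label Π))))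
                                   (trans (label-new-block Π m (≤-all _ Π<m)) (+-comm (label Π) 1)) ⟩
  range1 (label Π) ++ suc (label Π) ∷ []
    ≡⟨ range1-snoc (label Π) ⟨
  range1 (suc (label Π)) ∎
  where open ≡-Reasoning

Good : ℕ → Blocks → Set
Good n Π = IsSetPartition n Π × ¬ Has231 (Flatten Π)

covers⇒bounded : ∀ {n} xs → xs ↭ range1 n → All (_< suc n) xs
covers⇒bounded xs xs↭ = All.tabulate λ x∈ → in-range (∈-resp-↭ xs↭ x∈)
  where
  in-range : ∀ {n x} → x ∈ range1 n → x < suc n
  in-range x∈ with y , y∈ , refl ← ∈-map⁻ suc x∈ = s≤s (∈-upTo⁻ y∈)

good⇒bounded : ∀ {n} Π → Good n Π → All (_< suc n) (Flatten Π)
good⇒bounded Π (isp , _) = covers⇒bounded (Flatten Π) (exactCover isp)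

cover-insert : ∀ n X Y → X ++ Y ↭ range1 n → X ++ suc n ∷ Y ↭ range1 (suc n)
cover-insert n X Y X++Y↭ = subst (X ++ suc n ∷ Y ↭_) (sym (range1-snoc n))
  (↭-trans (shift (suc n) X Y) (↭-trans (∷↭∷ʳ (suc n) (X ++ Y)) (++⁺ʳ (suc n ∷ []) X++Y↭)))

cover-delete : ∀ n X Y → X ++ suc n ∷ Y ↭ range1 (suc n) → X ++ Y ↭ range1 n
cover-delete n X Y X++m++Y↭ = subst (X ++ Y ↭_) (++-identityʳ (range1 n))
  (drop-mid X (range1 n) (subst (X ++ suc n ∷ Y ↭_) (range1-snoc n) X++m++Y↭))

all-mid : ∀ {A : Set} {Q : A → Set} xs x ys → All Q (xs ++ x ∷ ys) → Q x
all-mid xs x ys q = All.head (All.++⁻ʳ xs q)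

all-replace : ∀ {A : Set} {Q : A → Set} xs x y ys → All Q (xs ++ x ∷ ys) → Q y → All Q (xs ++ y ∷ ys)
all-replace xs x y ys q qy with qxs , _ ∷ qys ← All.++⁻ xs q = All.++⁺ qxs (qy ∷ qys)

linked-snoc : ∀ {A : Set} {R : A → A → Set} xs y → Linked R xs → All (λ x → R x y) xs → Linked R (xs ∷ʳ y)
linked-snoc []           y _       _           = [-]
linked-snoc (x ∷ [])     y _       (r ∷ _)     = r ∷ [-]
linked-snoc (x ∷ x′ ∷ xs) y (r ∷ l) (_ ∷ rs)   = r ∷ linked-snoc (x′ ∷ xs) y l rs

linked-prefix : ∀ {A : Set} {R : A → A → Set} xs ys → Linked R (xs ++ ys) → Linked R xs
linked-prefix []            ys _       = []
linked-prefix (x ∷ [])      ys _       = [-]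
linked-prefix (x ∷ x′ ∷ xs) ys (r ∷ l) = r ∷ linked-prefix (x′ ∷ xs) ys l

linked-mid : ∀ {A : Set} {R : A → A → Set} xs y z zs → Linked R (xs ++ y ∷ z ∷ zs) → R y z
linked-mid []       y z zs l = Linked.head l
linked-mid (x ∷ xs) y z zs l = linked-mid xs y z zs (Linked.tail l)

-- Blocks are ordered by their first entries only, so a block may be changed freely
-- behind its first entry.
ordered-replace : ∀ P b B B′ S → Linked FirstLt (P ++ (b ∷ B) ∷ S) → Linked FirstLt (P ++ (b ∷ B′) ∷ S)
ordered-replace []              b B B′ []           _       = [-]
ordered-replace []              b B B′ ((_ ∷ _) ∷ S) (r ∷ l) = r ∷ l
ordered-replace ((_ ∷ _) ∷ [])  b B B′ S            (r ∷ l) = r ∷ ordered-replace [] b B B′ S l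
ordered-replace ([] ∷ [])       b B B′ S            (() ∷ _)
ordered-replace (X ∷ Y ∷ P)     b B B′ S            (r ∷ l) = r ∷ ordered-replace (Y ∷ P) b B B′ S l

Flatten-split : ∀ P B S → Flatten (P ++ B ∷ S) ≡ (Flatten P ++ B) ++ Flatten S
Flatten-split P B S = trans (Flatten-mid P B S) (sym (++-assoc (Flatten P) B (Flatten S)))

Flatten-extend : ∀ P B S (m : ℕ) → Flatten (P ++ (B ∷ʳ m) ∷ S) ≡ (Flatten P ++ B) ++ m ∷ Flatten S
Flatten-extend P B S m = trans (Flatten-mid P (B ∷ʳ m) S)
  (trans (cong (Flatten P ++_) (++-assoc B (m ∷ []) (Flatten S))) (sym (++-assoc (Flatten P) B (m ∷ Flatten S))))

good-extend : ∀ n P b B S → Good n (P ++ (b ∷ B) ∷ S) →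
  Below (Flatten P ++ b ∷ B) (Flatten S) → Good (suc n) (P ++ (b ∷ B ∷ʳ suc n) ∷ S)
good-extend n P b B S g@(isp , avoids) below = record
  { nonempty   = all-replace P _ _ S (nonempty isp) (λ ())
  ; increasing = all-replace P _ _ S (increasing isp)
      (linked-snoc (b ∷ B) m (all-mid P _ S (increasing isp)) (All.++⁻ʳ (Flatten P) (All.++⁻ˡ X XY<m)))
  ; ordered    = ordered-replace P b B (B ∷ʳ m) S (ordered isp)
  ; exactCover = subst (_↭ range1 (suc n)) (sym (Flatten-extend P (b ∷ B) S m))
      (cover-insert n X Y (subst (_↭ range1 n) (Flatten-split P (b ∷ B) S) (exactCover isp)))
  } , subst (¬_ ∘ Has231) (sym (Flatten-extend P (b ∷ B) S m))
        (avoids-insert-max X Y m (All.++⁻ˡ X XY<m) (All.++⁻ʳ X XY<m)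
          (subst (¬_ ∘ Has231) (Flatten-split P (b ∷ B) S) avoids) below)
  where
  m = suc n
  X = Flatten P ++ b ∷ B
  Y = Flatten S
  XY<m : All (_< m) (X ++ Y)
  XY<m = subst (All (_< m)) (Flatten-split P (b ∷ B) S) (good⇒bounded _ g)

good-new-block : ∀ n P → Good n P → Good (suc n) (P ∷ʳ (suc n ∷ []))
good-new-block n P g@(isp , avoids) = record
  { nonempty   = All.∷ʳ⁺ (nonempty isp) (λ ())
  ; increasing = All.∷ʳ⁺ (increasing isp) [-]
  ; ordered    = linked-snoc P (suc n ∷ []) (ordered isp) (firsts-below P (nonempty isp) (good⇒bounded P g))
  ; exactCover = subst (_↭ range1 (suc n)) (sym (Flatten-snoc P (suc n ∷ [])))
      (cover-insert n (Flatten P) [] (subst (_↭ range1 n) (sym (++-identityʳ (Flatten P))) (exactCover isp)))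
  } , subst (¬_ ∘ Has231) (sym (Flatten-snoc P (suc n ∷ [])))
        (avoids-insert-max (Flatten P) [] (suc n) (good⇒bounded P g) []
          (subst (¬_ ∘ Has231) (sym (++-identityʳ (Flatten P))) avoids) (below-[] _))
  where
  firsts-below : ∀ {m} P → NonEmpty P → All (_< m) (Flatten P) → All (λ B → FirstLt B (m ∷ [])) P
  firsts-below []            _          _           = []
  firsts-below ([] ∷ P)      (ne ∷ _)   _           = ⊥-elim (ne refl)
  firsts-below ((b ∷ B) ∷ P) (_ ∷ nes) (b<m ∷ P<m) = b<m ∷ firsts-below P nes (All.++⁻ʳ B P<m)

Extension : ℕ → Blocks → Blocks → Set
Extension m P Π = Σ Blocks λ P₁ → Σ (List ℕ) λ B → Σ Blocks λ S →
  (P ≡ P₁ ++ B ∷ S) × Below (Flatten P₁ ++ B) (Flatten S ++ []) × (Π ≡ P₁ ++ (B ∷ʳ m) ∷ S)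

extension-shift : ∀ m pre B S Π → Extension m ((pre ∷ʳ B) ++ S) Π → Extension m (pre ++ B ∷ S) Π
extension-shift m pre B S Π (P₁ , B′ , S′ , eq , below , eq′) =
  P₁ , B′ , S′ , trans (sym (++-assoc pre (B ∷ []) S)) eq , below , eq′

∈extensions⇒extension : ∀ m pre rest Π → Π ∈ extensions m pre rest → Extension m (pre ++ rest) Π
∈extensions⇒extension m pre (B ∷ S) Π Π∈ with below? (Flatten pre ++ B) (Flatten S ++ []) | Π∈
... | yes below | here eq   = pre , B , S , refl , below , eq
... | yes _     | there Π∈′ = extension-shift m pre B S Π (∈extensions⇒extension m (pre ∷ʳ B) S Π Π∈′)
... | no _      | Π∈′       = extension-shift m pre B S Π (∈extensions⇒extension m (pre ∷ʳ B) S Π Π∈′)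

shifted-prefix : ∀ m pre K Q B S → Below (Flatten (pre ++ K ∷ Q) ++ B) (Flatten S ++ []) →
  (pre ++ K ∷ Q) ++ (B ∷ʳ m) ∷ S ∈ extensions m (pre ∷ʳ K) (Q ++ B ∷ S)

extension⇒∈extensions : ∀ m pre Q B S → Below (Flatten (pre ++ Q) ++ B) (Flatten S ++ []) →
  (pre ++ Q) ++ (B ∷ʳ m) ∷ S ∈ extensions m pre (Q ++ B ∷ S)
extension⇒∈extensions m pre [] B S below with below? (Flatten pre ++ B) (Flatten S ++ [])
... | yes _ = here (cong (λ z → z ++ (B ∷ʳ m) ∷ S) (++-identityʳ pre))
... | no ¬below = ⊥-elim (¬below (subst (λ z → Below (Flatten z ++ B) (Flatten S ++ [])) (++-identityʳ pre) below))
extension⇒∈extensions m pre (K ∷ Q) B S below with below? (Flatten pre ++ K) (Flatten (Q ++ B ∷ S) ++ [])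
... | yes _ = there (shifted-prefix m pre K Q B S below)
... | no _  = shifted-prefix m pre K Q B S below

shifted-prefix m pre K Q B S below =
  subst (λ z → z ++ (B ∷ʳ m) ∷ S ∈ extensions m (pre ∷ʳ K) (Q ++ B ∷ S)) assoc
    (extension⇒∈extensions m (pre ∷ʳ K) Q B S (subst (λ z → Below (Flatten z ++ B) (Flatten S ++ [])) (sym assoc) below))
  where
  assoc : (pre ∷ʳ K) ++ Q ≡ pre ++ K ∷ Q
  assoc = ++-assoc pre (K ∷ []) Q

good-child : ∀ n P Π → Good n P → Π ∈ children (suc n) P → Good (suc n) Π
good-child n P Π g Π∈ with ∈-++⁻ (extensions (suc n) [] P) Π∈
... | inj₂ (here refl) = good-new-block n P g
... | inj₁ Π∈ext with ∈extensions⇒extension (suc n) [] P Π Π∈ext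
...   | P₁ , []    , S , refl , _     , refl = ⊥-elim (all-mid P₁ [] S (nonempty (proj₁ g)) refl)
...   | P₁ , b ∷ B , S , refl , below , refl =
  good-extend n P₁ b B S g (subst (Below (Flatten P₁ ++ b ∷ B)) (++-identityʳ (Flatten S)) below)

locate : ∀ {m} Π → m ∈ Flatten Π →
  Σ Blocks λ P₁ → Σ (List ℕ) λ C₁ → Σ (List ℕ) λ C₂ → Σ Blocks λ S → Π ≡ P₁ ++ (C₁ ++ m ∷ C₂) ∷ S
locate Π m∈ with ∈-concat⁻′ Π m∈
... | K , m∈K , K∈Π with ∈-∃++ K∈Π
...   | P₁ , S , refl with ∈-∃++ m∈K
...     | C₁ , C₂ , refl = P₁ , C₁ , C₂ , S , refl

max∈ : ∀ n Π → Good (suc n) Π → suc n ∈ Flatten Π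
max∈ n Π (isp , _) = ∈-resp-↭ (↭-sym (exactCover isp))
  (subst (suc n ∈_) (sym (range1-snoc n)) (∈-++⁺ʳ (range1 n) (here refl)))

block-entries : ∀ {Q : ℕ → Set} P K S → All Q (Flatten (P ++ K ∷ S)) → All Q K
block-entries P K S q = All.++⁻ˡ K (All.++⁻ʳ (Flatten P) (subst (All _) (Flatten-mid P K S) q))

entries-after : ∀ {Q : ℕ → Set} P K S → All Q (Flatten (P ++ K ∷ S)) → All Q (Flatten S)
entries-after P K S q = All.++⁻ʳ K (All.++⁻ʳ (Flatten P) (subst (All _) (Flatten-mid P K S) q))

max-ends-block : ∀ n P C₁ c C₂ S → ¬ Good (suc n) (P ++ (C₁ ++ suc n ∷ c ∷ C₂) ∷ S)
max-ends-block n P C₁ c C₂ S g = <⇒≱ m<c (≤-pred c≤m)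
  where
  m<c : suc n < c
  m<c = linked-mid C₁ (suc n) c C₂ (all-mid P _ S (increasing (proj₁ g)))
  c≤m : c < suc (suc n)
  c≤m = All.head (All.++⁻ʳ (suc n ∷ []) (All.++⁻ʳ C₁ (block-entries P _ S (good⇒bounded _ g))))

max-singleton-last : ∀ n P D S → ¬ Good (suc n) (P ++ (suc n ∷ []) ∷ D ∷ S)
max-singleton-last n P []      S (isp , _) = all-mid (P ++ (suc n ∷ []) ∷ []) [] S
  (subst (All _) (sym (++-assoc P ((suc n ∷ []) ∷ []) ([] ∷ S))) (nonempty isp)) refl
max-singleton-last n P (d ∷ D) S g@(isp , _) = <⇒≱ m<d (≤-pred d≤m)
  where
  m<d : suc n < d
  m<d = linked-mid P (suc n ∷ []) (d ∷ D) S (ordered isp)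
  d≤m : d < suc (suc n)
  d≤m = All.head (entries-after P (suc n ∷ []) ((d ∷ D) ∷ S) (good⇒bounded _ g))

parent-new-block : ∀ n P → Good (suc n) (P ++ (suc n ∷ []) ∷ []) → Good n P
parent-new-block n P (isp , avoids) = record
  { nonempty   = All.++⁻ˡ P (nonempty isp)
  ; increasing = All.++⁻ˡ P (increasing isp)
  ; ordered    = linked-prefix P _ (ordered isp)
  ; exactCover = subst (_↭ range1 n) (++-identityʳ (Flatten P))
      (cover-delete n (Flatten P) [] (subst (_↭ range1 (suc n)) (Flatten-snoc P (suc n ∷ [])) (exactCover isp)))
  } , subst (¬_ ∘ Has231) (++-identityʳ (Flatten P))
        (avoids-delete (Flatten P) [] (suc n) (subst (¬_ ∘ Has231) (Flatten-snoc P (suc n ∷ [])) avoids))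

parent-extend : ∀ n P c K S → Good (suc n) (P ++ (c ∷ K ∷ʳ suc n) ∷ S) →
  Good n (P ++ (c ∷ K) ∷ S) × Below (Flatten P ++ c ∷ K) (Flatten S)
parent-extend n P c K S (isp , avoids) = (record
  { nonempty   = all-replace P _ (c ∷ K) S (nonempty isp) (λ ())
  ; increasing = all-replace P _ (c ∷ K) S (increasing isp) (linked-prefix (c ∷ K) _ (all-mid P _ S (increasing isp)))
  ; ordered    = ordered-replace P c (K ∷ʳ suc n) K S (ordered isp)
  ; exactCover = subst (_↭ range1 n) (sym (Flatten-split P (c ∷ K) S)) X++Y↭
  } , subst (¬_ ∘ Has231) (sym (Flatten-split P (c ∷ K) S)) (avoids-delete X Y (suc n) avoids′))
  , avoids⇒below X Y (suc n) (All.++⁻ˡ X (covers⇒bounded (X ++ Y) X++Y↭)) avoids′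
  where
  X = Flatten P ++ c ∷ K
  Y = Flatten S
  X++Y↭ : X ++ Y ↭ range1 n
  X++Y↭ = cover-delete n X Y (subst (_↭ range1 (suc n)) (Flatten-extend P (c ∷ K) S (suc n)) (exactCover isp))
  avoids′ : ¬ Has231 (X ++ suc n ∷ Y)
  avoids′ = subst (¬_ ∘ Has231) (Flatten-extend P (c ∷ K) S (suc n)) avoids

good-parent : ∀ n Π → Good (suc n) Π → Σ Blocks λ P → Good n P × Π ∈ children (suc n) P
good-parent n Π g with locate Π (max∈ n Π g)
... | P , C₁     , c ∷ C₂ , S     , refl = ⊥-elim (max-ends-block n P C₁ c C₂ S g)
... | P , []     , []     , D ∷ S , refl = ⊥-elim (max-singleton-last n P D S g)
... | P , []     , []     , []    , refl = P , parent-new-block n P g , ∈-++⁺ʳ (extensions (suc n) [] P) (here refl)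
... | P , c ∷ K  , []     , S     , refl with g′ , below ← parent-extend n P c K S g =
  P ++ (c ∷ K) ∷ S , g′ ,
  ∈-++⁺ˡ (extension⇒∈extensions (suc n) [] P (c ∷ K) S (subst (Below _) (sym (++-identityʳ (Flatten S))) below))

_∷?_ : List ℕ → Blocks → Blocks
[]      ∷? S = S
(x ∷ B) ∷? S = (x ∷ B) ∷ S

∷?-++ : ∀ B R S → B ∷? (R ++ S) ≡ (B ∷? R) ++ S
∷?-++ []      R S = refl
∷?-++ (x ∷ B) R S = refl

parent : ℕ → Blocks → Blocks
parent m []      = []
parent m (B ∷ S) = filter (_<? m) B ∷? parent m S

parent-++ : ∀ m X Y → parent m (X ++ Y) ≡ parent m X ++ parent m Y
parent-++ m []      Y = refl
parent-++ m (B ∷ X) Y = trans (cong (filter (_<? m) B ∷?_) (parent-++ m X Y)) (∷?-++ (filter (_<? m) B) (parent m X) (parent m Y))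

parent-id : ∀ m X → All (All (_< m)) X → NonEmpty X → parent m X ≡ X
parent-id m []            _          _        = refl
parent-id m ([] ∷ X)      _          (ne ∷ _) = ⊥-elim (ne refl)
parent-id m ((b ∷ B) ∷ X) (B<m ∷ X<m) (_ ∷ ne) =
  cong₂ _∷?_ (filter-all (_<? m) B<m) (parent-id m X X<m ne)

filter-snoc-max : ∀ m B → All (_< m) B → filter (_<? m) (B ∷ʳ m) ≡ B
filter-snoc-max m B B<m = begin
  filter (_<? m) (B ++ m ∷ [])             ≡⟨ filter-++ (_<? m) B (m ∷ []) ⟩
  filter (_<? m) B ++ filter (_<? m) (m ∷ []) ≡⟨ cong₂ _++_ (filter-all (_<? m) B<m) (filter-reject (_<? m) (<-irrefl refl)) ⟩
  B ++ []                                  ≡⟨ ++-identityʳ B ⟩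
  B                                        ∎
  where open ≡-Reasoning

parent-child : ∀ n P Π → Good n P → Π ∈ children (suc n) P → parent (suc n) Π ≡ P
parent-child n P Π g Π∈ with ∈-++⁻ (extensions (suc n) [] P) Π∈
... | inj₂ (here refl) = begin
  parent m (P ++ (m ∷ []) ∷ [])    ≡⟨ parent-++ m P ((m ∷ []) ∷ []) ⟩
  parent m P ++ parent m ((m ∷ []) ∷ []) ≡⟨ cong₂ _++_ (parent-id m P (All.concat⁻ (good⇒bounded P g)) (nonempty (proj₁ g)))
                                                  (cong (_∷? []) (filter-snoc-max m [] [])) ⟩
  P ++ []                          ≡⟨ ++-identityʳ P ⟩
  P                                ∎
  where
  open ≡-Reasoning
  m = suc n
... | inj₁ Π∈ext with ∈extensions⇒extension (suc n) [] P Π Π∈ext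
...   | P₁ , B , S , refl , _ , refl = begin
  parent m (P₁ ++ (B ∷ʳ m) ∷ S)                        ≡⟨ parent-++ m P₁ _ ⟩
  parent m P₁ ++ (filter (_<? m) (B ∷ʳ m) ∷? parent m S) ≡⟨ cong₂ (λ X B′ → X ++ (B′ ∷? parent m S))
                                                            (parent-id m P₁ (All.++⁻ˡ P₁ P<m) (All.++⁻ˡ P₁ ne))
                                                            (filter-snoc-max m B (all-mid P₁ B S P<m)) ⟩
  P₁ ++ (B ∷? parent m S)                             ≡⟨ cong (λ S′ → P₁ ++ (B ∷? S′))
                                                            (parent-id m S (All.++⁻ʳ (B ∷ []) (All.++⁻ʳ P₁ P<m)) (All.++⁻ʳ (B ∷ []) (All.++⁻ʳ P₁ ne))) ⟩
  P₁ ++ (B ∷? S)                                      ≡⟨ cong (P₁ ++_) (nonempty-∷? B S (all-mid P₁ B S ne)) ⟩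
  P₁ ++ B ∷ S                                          ∎
  where
  open ≡-Reasoning
  m = suc n
  P<m : All (All (_< m)) (P₁ ++ B ∷ S)
  P<m = All.concat⁻ (good⇒bounded _ g)
  ne = nonempty (proj₁ g)
  nonempty-∷? : ∀ B S → ¬ B ≡ [] → B ∷? S ≡ B ∷ S
  nonempty-∷? []      S ne = ⊥-elim (ne refl)
  nonempty-∷? (x ∷ B) S _  = refl

-- The children of a good partition are distinct, because their labels 1, …, label + 1 are.
unique-children : ∀ n P → Good n P → Unique (children (suc n) P)
unique-children n P g = Unique.map⁻ {f = label}
  (subst Unique (sym (labels-children (suc n) P (good⇒bounded P g) (nonempty (proj₁ g))))
    (Unique.map⁺ suc-injective (Unique.upTo⁺ _)))

next-level : ℕ → List Blocks → List Blocks
next-level n X = concatMap (children (suc n)) X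

∈next-level⁻ : ∀ n X Π → Π ∈ next-level n X → Σ Blocks λ P → P ∈ X × Π ∈ children (suc n) P
∈next-level⁻ n X Π = find ∘ ∈-concatMap⁻ (children (suc n))

unique-next-level : ∀ n X → Unique X → All (Good n) X → Unique (next-level n X)
unique-next-level n []      _            _        = []
unique-next-level n (P ∷ X) (P∉X ∷ uniq) (g ∷ gs) =
  Unique.++⁺ (unique-children n P g) (unique-next-level n X uniq gs) disjoint
  where
  disjoint : ∀ {Π} → ¬ (Π ∈ children (suc n) P × Π ∈ next-level n X)
  disjoint {Π} (Π∈ , Π∈next) with P′ , P′∈X , Π∈′ ← ∈next-level⁻ n X Π Π∈next =
    All.lookup P∉X P′∈X (trans (sym (parent-child n P Π g Π∈)) (parent-child n P′ Π (All.lookup gs P′∈X) Π∈′))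

good-partitions : ℕ → List Blocks
good-partitions zero    = [] ∷ []
good-partitions (suc n) = next-level n (good-partitions n)

good-0 : ∀ Π → Good 0 Π → Π ≡ []
good-0 []            _         = refl
good-0 ([] ∷ Π)      (isp , _) = ⊥-elim (All.head (nonempty isp) refl)
good-0 ((b ∷ B) ∷ Π) (isp , _) with () ← ↭-empty-inv (exactCover isp)

∈good-partitions : ∀ n Π → Π ∈ good-partitions n ⇔ Good n Π
∈good-partitions zero Π = mk⇔
  (λ { (here refl) → record { nonempty = [] ; increasing = [] ; ordered = [] ; exactCover = ↭-refl } , λ () })
  (λ g → here (good-0 Π g))
∈good-partitions (suc n) Π = mk⇔
  (λ Π∈ → let P , P∈ , Π∈ch = ∈next-level⁻ n (good-partitions n) Π Π∈
          in good-child n P Π (Equivalence.to (∈good-partitions n P) P∈) Π∈ch)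
  (λ g → let P , gP , Π∈ch = good-parent n Π g
         in ∈-concatMap⁺ (children (suc n)) (lose (Equivalence.from (∈good-partitions n P) gP) Π∈ch))

unique-good-partitions : ∀ n → Unique (good-partitions n)
unique-good-partitions zero    = [] ∷ []
unique-good-partitions (suc n) = unique-next-level n (good-partitions n) (unique-good-partitions n)
  (All.tabulate (Equivalence.to (∈good-partitions n _)))

-- weight k X: the number of nodes k levels below the members of X.
weight : ℕ → List Blocks → ℕ
weight k X = sum (map (leaves k ∘ label) X)

length≡weight : ∀ X → length X ≡ weight 0 X
length≡weight []      = refl
length≡weight (P ∷ X) = cong suc (length≡weight X)

weight-concatMap : ∀ k (f : Blocks → List Blocks) X → weight k (concatMap f X) ≡ sum (map (weight k ∘ f) X)
weight-concatMap k f []      = refl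
weight-concatMap k f (P ∷ X) = begin
  sum (map (leaves k ∘ label) (f P ++ concatMap f X))              ≡⟨ cong sum (map-++ (leaves k ∘ label) (f P) _) ⟩
  sum (map (leaves k ∘ label) (f P) ++ map (leaves k ∘ label) (concatMap f X)) ≡⟨ sum-++ (map (leaves k ∘ label) (f P)) _ ⟩
  weight k (f P) + weight k (concatMap f X)                        ≡⟨ cong (weight k (f P) +_) (weight-concatMap k f X) ⟩
  weight k (f P) + sum (map (weight k ∘ f) X)                      ∎
  where open ≡-Reasoning

-- Since the children of P are labelled 1, …, label P + 1, descending one level of
-- the tree moves one level of depth from the weight into the list.
weight-children : ∀ n k P → Good n P → weight k (children (suc n) P) ≡ leaves (suc k) (label P)
weight-children n k P g = cong sum (trans (map-∘ (children (suc n) P))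
  (cong (map (leaves k)) (labels-children (suc n) P (good⇒bounded P g) (nonempty (proj₁ g)))))

weight-next-level : ∀ n k X → All (Good n) X → weight k (next-level n X) ≡ weight (suc k) X
weight-next-level n k X gs = trans (weight-concatMap k (children (suc n)) X) (sum-cong X gs)
  where
  sum-cong : ∀ X → All (Good n) X → sum (map (weight k ∘ children (suc n)) X) ≡ weight (suc k) X
  sum-cong []      []       = refl
  sum-cong (P ∷ X) (g ∷ gs) = cong₂ _+_ (weight-children n k P g) (sum-cong X gs)

weight-good-partitions : ∀ n k → weight k (good-partitions n) ≡ leaves (n + k) 0
weight-good-partitions zero    k = +-identityʳ (leaves k 0)
weight-good-partitions (suc n) k = begin
  weight k (next-level n (good-partitions n)) ≡⟨ weight-next-level n k _ (All.tabulate (Equivalence.to (∈good-partitions n _))) ⟩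
  weight (suc k) (good-partitions n)          ≡⟨ weight-good-partitions n (suc k) ⟩
  leaves (n + suc k) 0                        ≡⟨ cong (λ d → leaves d 0) (+-suc n k) ⟩
  leaves (suc n + k) 0                        ∎
  where open ≡-Reasoning

length-good-partitions : ∀ n → length (good-partitions n) ≡ leaves n 0
length-good-partitions n = begin
  length (good-partitions n)   ≡⟨ length≡weight (good-partitions n) ⟩
  weight 0 (good-partitions n) ≡⟨ weight-good-partitions n 0 ⟩
  leaves (n + 0) 0             ≡⟨ cong (λ d → leaves d 0) (+-identityʳ n) ⟩
  leaves n 0                   ∎
  where open ≡-Reasoning

-- The count: the good partitions of [n] are enumerated without repetition by level n
-- of the generating tree, whose size is the number of leaves at depth n below the
-- root label 0, which is the Catalan number.
mainTheorem4 : (n : ℕ) → n ≥ 1 →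
    HasCount (λ Π → IsSetPartition n Π × Avoids (Flatten Π) pat231) (catalan n)
mainTheorem4 n _ =
  good-partitions n , unique-good-partitions n , membership ,
  trans (length-good-partitions n) (sym (catalan≡leaves n))
  where
  membership : ∀ Π → Π ∈ good-partitions n ⇔ (IsSetPartition n Π × Avoids (Flatten Π) pat231)
  membership Π = mk⇔
    (λ Π∈ → let isp , avoids = Equivalence.to (∈good-partitions n Π) Π∈
            in isp , Equivalence.from (avoids⇔¬has231 (Flatten Π)) avoids)
    (λ (isp , avoids) → Equivalence.from (∈good-partitions n Π) (isp , Equivalence.to (avoids⇔¬has231 (Flatten Π)) avoids))
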